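{- Let $m\ge 2$ and $n\ge 2$. Let $\alpha=\alpha_1\cdots\alpha_{2m}\in\mathcal{C}_{2m}(132)$ with $\{\alpha_1,\dots,\alpha_m\}=\{m+1,\dots,2m\}$, and let $\beta=\beta_1\cdots\beta_n\in\mathcal{C}_n(132)$. Define $$\alpha\circledast\beta=\bar\alpha_1\cdots\bar\alpha_{m-1}\,\bar\beta_1\cdots\bar\beta_{n-1}\,\bar\alpha_{m+1}\bar\alpha_{m+2}\cdots\bar\alpha_{2m}\in S_{n+2m-2},$$ where $\bar\alpha_i=\alpha_i+n-2$ if $i<m$; $\bar\alpha_i=\beta_n+m-1$ if $\alpha_i=m$; $\bar\alpha_i=\alpha_i$ if $i>m$ and $\alpha_i\neq m$; and $\bar\beta_i=\beta_i+m-1$ if $\beta_i\neq n$, $\bar\beta_i=\alpha_m+n-2$ if $\beta_i=n$. Then $\alpha\circledast\beta\in\mathcal{C}_{n+2m-2}(132)$.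
   Context: $\mathcal{C}_n(132)$ is the set of permutations of $[n]$ in one-line notation that consist of a single $n$-cycle and avoid the pattern $132$ (no indices $i<j<k$ with $\pi_i<\pi_k<\pi_j$). -}

module Defs where

open import Data.Nat using (ℕ; zero; suc; _+_; _∸_; _<_; _≤_; _≡ᵇ_)
open import Data.Bool using (if_then_else_)
open import Data.List using (List; []; _∷_; map; upTo; take; drop; length; lookup; _++_)
open import Data.List.Relation.Binary.Permutation.Propositional using (_↭_)
open import Data.Fin using (Fin; toℕ)
open import Data.Product using (_×_; ∃)
open import Relation.Binary.PropositionalEquality using (_≡_)
open import Relation.Nullary using (¬_)
open import Function using (_∘_)

range : ℕ → ℕ → List ℕ
range a k = map (λ i → a + suc i) (upTo k)

-- value at 1-indexed position i of a one-line word (0 if out of range)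
at : List ℕ → ℕ → ℕ
at []       _             = 0
at (x ∷ xs) zero          = 0
at (x ∷ xs) (suc zero)    = x
at (x ∷ xs) (suc (suc i)) = at xs (suc i)

iter : (ℕ → ℕ) → ℕ → ℕ → ℕ
iter f zero    x = x
iter f (suc k) x = f (iter f k x)

-- π is a permutation of [n] in one-line notation
IsPerm : ℕ → List ℕ → Set
IsPerm n π = π ↭ range 0 n

-- π consists of a single n-cycle: every j ∈ [n] lies in the orbit of 1
IsSingleCycle : ℕ → List ℕ → Set
IsSingleCycle n π = ∀ j → 1 ≤ j → j ≤ n → ∃ λ k → iter (at π) k 1 ≡ j

Avoids132 : List ℕ → Set
Avoids132 π = ∀ (i j k : Fin (length π)) → toℕ i < toℕ j → toℕ j < toℕ k →
  ¬ (lookup π i < lookup π k × lookup π k < lookup π j)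

C132 : ℕ → List ℕ → Set
C132 n π = IsPerm n π × IsSingleCycle n π × Avoids132 π

circledast : ℕ → ℕ → List ℕ → List ℕ → List ℕ
circledast m n α β =
  map (λ a → a + n ∸ 2) (take (m ∸ 1) α)
  ++ map (λ b → if b ≡ᵇ n then at α m + n ∸ 2 else b + m ∸ 1) (take (n ∸ 1) β)
  ++ map (λ a → if a ≡ᵇ m then at β n + m ∸ 1 else a) (drop m α)

-- Read α and β as maps on [1, 2m] and [1, n].  Deleting position m of α and position n of β and moving
-- the remaining positions and values by the order-preserving maps liftA and liftB gives α ⊛ β, where
-- the two deleted entries are glued crosswise: the cycle of α, on reaching m, continues in β at βₙ, and
-- the cycle of β, on reaching n, returns to α at αₘ.  So the two cycles merge into a single one.
-- A 132-pattern inside one block transfers back to α or β because both lifts are monotone.  A mixed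
-- pattern is impossible because the α-entries left of the β-block lie above all of it and those right
-- of it lie below (this is where {α₁,…,αₘ} = {m+1,…,2m} is used), except for the glued entries, which
-- turn such a pattern into one of α through position m or one of β through position n.
module Submission where

open import Defs
open import Data.Bool using (if_then_else_)
open import Data.Empty using (⊥-elim)
open import Data.Fin as Fin using (Fin; toℕ; fromℕ<)
import Data.Fin.Properties as Fin
open import Data.List using (List; []; _∷_; map; upTo; take; drop; length; lookup; _++_)
open import Data.List.Membership.Propositional using (_∈_)
open import Data.List.Membership.Propositional.Properties using (∈-map⁺; ∈-map⁻; ∈-upTo⁺; ∈-upTo⁻)
open import Data.List.Membership.Propositional.Properties.WithK using (unique∧set⇒bag)
open import Data.List.Properties using (length-map; length-upTo; length-take; length-drop; length-++; tabulate-lookup)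
open import Data.List.Relation.Binary.BagAndSetEquality using (∼bag⇒↭)
open import Data.List.Relation.Binary.Permutation.Propositional using (_↭_; ↭-sym; ↭⇒↭ₛ)
open import Data.List.Relation.Binary.Permutation.Propositional.Properties using (∈-resp-↭; ↭-length)
open import Data.List.Relation.Binary.Permutation.Setoid.Properties using (Unique-resp-↭)
import Data.List.Relation.Unary.All as All
open import Data.List.Relation.Unary.AllPairs using (_∷_)
open import Data.List.Relation.Unary.Any using (here; there)
open import Data.List.Relation.Unary.Unique.Propositional using (Unique)
import Data.List.Relation.Unary.Unique.Propositional.Properties as Unique
open import Data.Nat
open import Data.Nat.Properties
open import Data.Nat.Tactic.RingSolver using (solve-∀)
open import Data.Product using (∃; ∃₂; _×_; _,_; proj₁; proj₂; uncurry)
open import Data.Sum using (_⊎_; inj₁; inj₂)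
open import Function.Bundles using (mk⇔)
open import Relation.Binary.Definitions using (tri<; tri≈; tri>)
open import Relation.Binary.PropositionalEquality
open import Relation.Nullary using (¬_; Dec; yes; no; does)
open import Relation.Nullary.Decidable using (dec-true; dec-false)
open import Relation.Unary using (U)

at-∈ : ∀ (π : List ℕ) i → i < length π → at π (suc i) ∈ π
at-∈ (x ∷ π) zero    _          = here refl
at-∈ (x ∷ π) (suc i) (s≤s i<ℓ) = there (at-∈ π i i<ℓ)

∈⇒at : ∀ {π : List ℕ} {x} → x ∈ π → ∃ λ i → i < length π × at π (suc i) ≡ x
∈⇒at {y ∷ π} (here refl) = 0 , s≤s z≤n , refl
∈⇒at {y ∷ π} (there x∈π) with i , i<ℓ , eq ← ∈⇒at x∈π = suc i , s≤s i<ℓ , eq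

lookup≡at : ∀ (π : List ℕ) i → lookup π i ≡ at π (suc (toℕ i))
lookup≡at (x ∷ π) Fin.zero    = refl
lookup≡at (x ∷ π) (Fin.suc i) = lookup≡at π i

at-++ˡ : ∀ (xs ys : List ℕ) i → i < length xs → at (xs ++ ys) (suc i) ≡ at xs (suc i)
at-++ˡ (x ∷ xs) ys zero    _          = refl
at-++ˡ (x ∷ xs) ys (suc i) (s≤s i<ℓ) = at-++ˡ xs ys i i<ℓ

at-++ʳ : ∀ (xs ys : List ℕ) i → at (xs ++ ys) (suc (length xs + i)) ≡ at ys (suc i)
at-++ʳ []       ys i = refl
at-++ʳ (x ∷ xs) ys i = at-++ʳ xs ys i

at-map : ∀ (f : ℕ → ℕ) (xs : List ℕ) i → i < length xs → at (map f xs) (suc i) ≡ f (at xs (suc i))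
at-map f (x ∷ xs) zero    _          = refl
at-map f (x ∷ xs) (suc i) (s≤s i<ℓ) = at-map f xs i i<ℓ

at-take : ∀ k (xs : List ℕ) i → i < k → at (take k xs) (suc i) ≡ at xs (suc i)
at-take (suc k) []       i       _          = refl
at-take (suc k) (x ∷ xs) zero    _          = refl
at-take (suc k) (x ∷ xs) (suc i) (s≤s i<k) = at-take k xs i i<k

at-drop : ∀ k (xs : List ℕ) i → at (drop k xs) (suc i) ≡ at xs (suc (k + i))
at-drop zero    xs       i = refl
at-drop (suc k) []       i = refl
at-drop (suc k) (x ∷ xs) i = at-drop k xs i

length-take-≤ : ∀ k (xs : List ℕ) → k ≤ length xs → length (take k xs) ≡ k
length-take-≤ k xs k≤ℓ = trans (length-take k xs) (m≤n⇒m⊓n≡m k≤ℓ)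

Unique⇒at-injective : ∀ {π : List ℕ} → Unique π → ∀ i j → i < length π → j < length π →
  at π (suc i) ≡ at π (suc j) → i ≡ j
Unique⇒at-injective {x ∷ π} _            zero    zero    _         _         _  = refl
Unique⇒at-injective {x ∷ π} (x∉π ∷ _)   zero    (suc j) _         (s≤s j<ℓ) eq =
  ⊥-elim (All.lookup x∉π (at-∈ π j j<ℓ) eq)
Unique⇒at-injective {x ∷ π} (x∉π ∷ _)   (suc i) zero    (s≤s i<ℓ) _         eq =
  ⊥-elim (All.lookup x∉π (at-∈ π i i<ℓ) (sym eq))
Unique⇒at-injective {x ∷ π} (_ ∷ uπ)    (suc i) (suc j) (s≤s i<ℓ) (s≤s j<ℓ) eq =
  cong suc (Unique⇒at-injective uπ i j i<ℓ j<ℓ eq)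

at-injective⇒Unique : ∀ (π : List ℕ) → (∀ i j → i < length π → j < length π →
  at π (suc i) ≡ at π (suc j) → i ≡ j) → Unique π
at-injective⇒Unique π inj = subst Unique (tabulate-lookup π) (Unique.tabulate⁺ lookup-injective)
  where
  lookup-injective : ∀ {i j} → lookup π i ≡ lookup π j → i ≡ j
  lookup-injective {i} {j} eq = Fin.toℕ-injective
    (inj (toℕ i) (toℕ j) (Fin.toℕ<n i) (Fin.toℕ<n j) (trans (sym (lookup≡at π i)) (trans eq (lookup≡at π j))))

_∈[1,_] : ℕ → ℕ → Set
x ∈[1, N ] = 1 ≤ x × x ≤ N

MapsInto : (ℕ → ℕ) → ℕ → Set
MapsInto f N = ∀ x → x ∈[1, N ] → f x ∈[1, N ]

InjectiveOn : (ℕ → ℕ) → ℕ → Set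
InjectiveOn f N = ∀ x y → x ∈[1, N ] → y ∈[1, N ] → f x ≡ f y → x ≡ y

Reaches : (ℕ → ℕ) → ℕ → ℕ → Set
Reaches f x y = ∃ λ k → iter f k x ≡ y

Cyclic : (ℕ → ℕ) → ℕ → Set
Cyclic f N = ∀ j → 1 ≤ j → j ≤ N → Reaches f 1 j

iter-suc : ∀ f k x → iter f (suc k) x ≡ iter f k (f x)
iter-suc f zero    x = refl
iter-suc f (suc k) x = cong f (iter-suc f k x)

iter-+ : ∀ f k l x → iter f (k + l) x ≡ iter f k (iter f l x)
iter-+ f zero    l x = refl
iter-+ f (suc k) l x = cong f (iter-+ f k l x)

iter-* : ∀ f p x → iter f p x ≡ x → ∀ t → iter f (t * p) x ≡ x
iter-* f p x period zero    = refl
iter-* f p x period (suc t) = begin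
  iter f (p + t * p) x        ≡⟨ iter-+ f p (t * p) x ⟩
  iter f p (iter f (t * p) x) ≡⟨ cong (iter f p) (iter-* f p x period t) ⟩
  iter f p x                  ≡⟨ period ⟩
  x                           ∎
  where open ≡-Reasoning

reaches-refl : ∀ {f x} → Reaches f x x
reaches-refl = 0 , refl

reaches-step : ∀ {f x y} → f x ≡ y → Reaches f x y
reaches-step eq = 1 , eq

reaches-trans : ∀ {f x y z} → Reaches f x y → Reaches f y z → Reaches f x z
reaches-trans {f} {x} (k , refl) (l , refl) = l + k , iter-+ f l k x

Periodic : (ℕ → ℕ) → ℕ → Set
Periodic f x = ∃ λ q → iter f (suc q) x ≡ x

reaches-back : ∀ {f x y} → Periodic f x → Reaches f x y → Reaches f y x
reaches-back {f} {x} (q , period) (k , refl) = q * k , (begin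
  iter f (q * k) (iter f k x) ≡⟨ iter-+ f (q * k) k x ⟨
  iter f (q * k + k) x        ≡⟨ cong (λ t → iter f t x) (trans (+-comm (q * k) k) (*-comm (suc q) k)) ⟩
  iter f (k * suc q) x        ≡⟨ iter-* f (suc q) x period k ⟩
  x                           ∎)
  where open ≡-Reasoning

pred-injectiveOn : ∀ {x y} → 1 ≤ x → 1 ≤ y → pred x ≡ pred y → x ≡ y
pred-injectiveOn {suc x} {suc y} _ _ eq = cong suc eq

pred<bound : ∀ {y N} → y ∈[1, N ] → pred y < N
pred<bound {suc y} (_ , y<N) = y<N

iter-into : ∀ {f N} → MapsInto f N → ∀ k x → x ∈[1, N ] → iter f k x ∈[1, N ]
iter-into f-into zero    x x∈ = x∈
iter-into f-into (suc k) x x∈ = f-into _ (iter-into f-into k x x∈)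

module InjectiveSelfMap (f : ℕ → ℕ) (N : ℕ) (f-into : MapsInto f N) (f-inj : InjectiveOn f N) where

  iter-cancel : ∀ i d x → x ∈[1, N ] → iter f i x ≡ iter f (i + d) x → x ≡ iter f d x
  iter-cancel zero    d x x∈ eq = eq
  iter-cancel (suc i) d x x∈ eq =
    iter-cancel i d x x∈ (f-inj _ _ (iter-into f-into i x x∈) (iter-into f-into (i + d) x x∈) eq)

  -- Pigeonhole on the first N + 1 points of the orbit, then cancel the common prefix.
  periodic : ∀ x → x ∈[1, N ] → Periodic f x
  periodic x x∈ = from-collision (Fin.pigeonhole (n<1+n N) slot)
    where
    pred<N : ∀ t → pred (iter f t x) < N
    pred<N t = pred<bound (iter-into f-into t x x∈)
    slot : Fin (suc N) → Fin N
    slot t = fromℕ< (pred<N (toℕ t))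
    from-collision : (∃₂ λ i j → i Fin.< j × slot i ≡ slot j) → Periodic f x
    from-collision (i , j , i<j , slotᵢ≡slotⱼ) with d , i+1+d≡j ← m≤n⇒∃[o]m+o≡n i<j =
      d , sym (iter-cancel (toℕ i) (suc d) x x∈ (trans xᵢ≡xⱼ (cong (λ t → iter f t x) j≡i+1+d)))
      where
      j≡i+1+d : toℕ j ≡ toℕ i + suc d
      j≡i+1+d = trans (sym i+1+d≡j) (sym (+-suc (toℕ i) d))
      xᵢ≡xⱼ : iter f (toℕ i) x ≡ iter f (toℕ j) x
      xᵢ≡xⱼ = pred-injectiveOn (proj₁ (iter-into f-into (toℕ i) x x∈)) (proj₁ (iter-into f-into (toℕ j) x x∈))
        (trans (sym (Fin.toℕ-fromℕ< (pred<N (toℕ i))))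
               (trans (cong toℕ slotᵢ≡slotⱼ) (Fin.toℕ-fromℕ< (pred<N (toℕ j)))))

  surjective : ∀ y → y ∈[1, N ] → ∃ λ x → x ∈[1, N ] × f x ≡ y
  surjective y y∈ with q ← proj₁ (periodic y y∈) | period ← proj₂ (periodic y y∈) =
    iter f q y , iter-into f-into q y y∈ , period

  module _ (f-cyclic : Cyclic f N) where

    connected : ∀ x y → x ∈[1, N ] → y ∈[1, N ] → Reaches f x y
    connected x y (1≤x , x≤N) (1≤y , y≤N) =
      reaches-trans (reaches-back (periodic 1 (≤-refl , ≤-trans 1≤x x≤N)) (f-cyclic x 1≤x x≤N))
                    (f-cyclic y 1≤y y≤N)

    fixed⇒≡1 : ∀ x → x ∈[1, N ] → f x ≡ x → x ≡ 1
    fixed⇒≡1 x x∈ fx≡x = trans (sym (iter-fixed (proj₁ x→1))) (proj₂ x→1)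
      where
      x→1 : Reaches f x 1
      x→1 = connected x 1 x∈ (≤-refl , ≤-trans (proj₁ x∈) (proj₂ x∈))
      iter-fixed : ∀ k → iter f k x ≡ x
      iter-fixed zero    = refl
      iter-fixed (suc k) = trans (cong f (iter-fixed k)) fx≡x

-- Splicing an orbit into another map

module Splice (f g e : ℕ → ℕ) (N c exit : ℕ) (f-into : MapsInto f N) (fc≢c : f c ≢ c)
  (g-e : ∀ x → x ∈[1, N ] → x ≢ c → f x ≢ c → g (e x) ≡ e (f x))
  (g-exit : ∀ x → x ∈[1, N ] → x ≢ c → f x ≡ c → g (e x) ≡ exit) where

  reaches-exit : ∀ {u} → u ∈[1, N ] → u ≢ c → Reaches f u c → Reaches g (e u) exit
  reaches-exit u∈ u≢c (k , fᵏu≡c) = go k u∈ u≢c fᵏu≡c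
    where
    go : ∀ k {u} → u ∈[1, N ] → u ≢ c → iter f k u ≡ c → Reaches g (e u) exit
    go zero        _  u≢c u≡c       = ⊥-elim (u≢c u≡c)
    go (suc k) {u} u∈ u≢c fᵏ⁺¹u≡c with f u ≟ c
    ... | yes fu≡c = reaches-step (g-exit u u∈ u≢c fu≡c)
    ... | no  fu≢c = reaches-trans (reaches-step (g-e u u∈ u≢c fu≢c))
      (go k (f-into u u∈) fu≢c (trans (sym (iter-suc f k u)) fᵏ⁺¹u≡c))

  module _ (reenter : Reaches g exit (e (f c))) where

    reaches : ∀ {u x} → u ∈[1, N ] → u ≢ c → x ≢ c → Reaches f u x → Reaches g (e u) (e x)
    reaches {u} u∈ u≢c x≢c (k , refl) = go k x≢c
      where
      go : ∀ k → iter f k u ≢ c → Reaches g (e u) (e (iter f k u))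
      go zero    _ = reaches-refl
      go (suc k) fᵏ⁺¹u≢c with iter f k u ≟ c
      ... | yes fᵏu≡c = reaches-trans (reaches-exit u∈ u≢c (k , fᵏu≡c))
        (subst (λ w → Reaches g exit (e (f w))) (sym fᵏu≡c) reenter)
      ... | no  fᵏu≢c = reaches-trans (go k fᵏu≢c)
        (reaches-step (g-e (iter f k u) (iter-into f-into k u u∈) fᵏu≢c fᵏ⁺¹u≢c))

-- Permutations and 132-avoidance, read off the one-line word

∈-range⁺ : ∀ {a k v} → a < v → v ≤ a + k → v ∈ range a k
∈-range⁺ {a} {k} a<v v≤a+k with d , refl ← m≤n⇒∃[o]m+o≡n a<v =
  subst (_∈ range a k) (+-suc a d)
    (∈-map⁺ (λ i → a + suc i) (∈-upTo⁺ (+-cancelˡ-≤ a (suc d) k (subst (_≤ a + k) (sym (+-suc a d)) v≤a+k))))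

∈-range⁻ : ∀ {a k v} → v ∈ range a k → a < v × v ≤ a + k
∈-range⁻ {a} v∈ with i , i∈ , refl ← ∈-map⁻ (λ i → a + suc i) v∈ =
  m<m+n a (s≤s z≤n) , +-monoʳ-≤ a (∈-upTo⁻ i∈)

length-range : ∀ a k → length (range a k) ≡ k
length-range a k = trans (length-map _ (upTo k)) (length-upTo k)

unique-range : ∀ a k → Unique (range a k)
unique-range a k = Unique.map⁺ (λ eq → suc-injective (+-cancelˡ-≡ a _ _ eq)) (Unique.upTo⁺ k)

module _ {N} {π : List ℕ} (π↭ : IsPerm N π) where

  IsPerm⇒length : length π ≡ N
  IsPerm⇒length = trans (↭-length π↭) (length-range 0 N)

  IsPerm⇒mapsInto : MapsInto (at π) N
  IsPerm⇒mapsInto (suc i) (_ , i<N) =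
    ∈-range⁻ (∈-resp-↭ π↭ (at-∈ π i (subst (i <_) (sym IsPerm⇒length) i<N)))

  IsPerm⇒injectiveOn : InjectiveOn (at π) N
  IsPerm⇒injectiveOn (suc i) (suc j) (_ , i<N) (_ , j<N) eq = cong suc
    (Unique⇒at-injective unique-π i j (<ℓ i<N) (<ℓ j<N) eq)
    where
    unique-π : Unique π
    unique-π = Unique-resp-↭ (setoid ℕ) (↭⇒↭ₛ (↭-sym π↭)) (unique-range 0 N)
    <ℓ : ∀ {i} → i < N → i < length π
    <ℓ = subst (_ <_) (sym IsPerm⇒length)

IsPerm-intro : ∀ {N} (π : List ℕ) → length π ≡ N → MapsInto (at π) N → InjectiveOn (at π) N → IsPerm N π
IsPerm-intro {N} π ℓ≡N π-into π-inj = ∼bag⇒↭ (unique∧set⇒bag unique-π (unique-range 0 N) (mk⇔ to from))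
  where
  open InjectiveSelfMap (at π) N π-into π-inj using (surjective)
  <N : ∀ {i} → i < length π → i < N
  <N = subst (_ <_) ℓ≡N
  unique-π : Unique π
  unique-π = at-injective⇒Unique π λ i j i<ℓ j<ℓ eq →
    suc-injective (π-inj (suc i) (suc j) (s≤s z≤n , <N i<ℓ) (s≤s z≤n , <N j<ℓ) eq)
  to : ∀ {x} → x ∈ π → x ∈ range 0 N
  to x∈π with i , i<ℓ , refl ← ∈⇒at x∈π = uncurry ∈-range⁺ (π-into (suc i) (s≤s z≤n , <N i<ℓ))
  from : ∀ {x} → x ∈ range 0 N → x ∈ π
  from x∈ with suc i , (_ , i<N) , refl ← surjective _ (∈-range⁻ x∈) = at-∈ π i (subst (i <_) (sym ℓ≡N) i<N)

Is132 : (ℕ → ℕ) → ℕ → ℕ → ℕ → Set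
Is132 f i j k = i < j × j < k × f i < f k × f k < f j

Avoids132On : (ℕ → ℕ) → ℕ → Set
Avoids132On f N = ∀ i j k → 1 ≤ i → k ≤ N → ¬ Is132 f i j k

lookup-fromℕ< : ∀ (π : List ℕ) {i} (i<ℓ : i < length π) → lookup π (fromℕ< i<ℓ) ≡ at π (suc i)
lookup-fromℕ< π i<ℓ = trans (lookup≡at π _) (cong (λ t → at π (suc t)) (Fin.toℕ-fromℕ< i<ℓ))

Avoids132⇒Avoids132On : ∀ {π} → Avoids132 π → Avoids132On (at π) (length π)
Avoids132⇒Avoids132On {π} avoids (suc i) (suc j) (suc k) _ k<ℓ (s≤s i<j , s≤s j<k , πᵢ<πₖ , πₖ<πⱼ) =
  avoids (fromℕ< i<ℓ) (fromℕ< j<ℓ) (fromℕ< k<ℓ) (toℕ-fromℕ<-< i<ℓ j<ℓ i<j) (toℕ-fromℕ<-< j<ℓ k<ℓ j<k)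
    (subst₂ _<_ (sym (lookup-fromℕ< π i<ℓ)) (sym (lookup-fromℕ< π k<ℓ)) πᵢ<πₖ ,
     subst₂ _<_ (sym (lookup-fromℕ< π k<ℓ)) (sym (lookup-fromℕ< π j<ℓ)) πₖ<πⱼ)
  where
  j<ℓ = <-trans j<k k<ℓ
  i<ℓ = <-trans i<j j<ℓ
  toℕ-fromℕ<-< : ∀ {x y} (x<ℓ : x < length π) (y<ℓ : y < length π) → x < y →
                 toℕ (fromℕ< x<ℓ) < toℕ (fromℕ< y<ℓ)
  toℕ-fromℕ<-< x<ℓ y<ℓ = subst₂ _<_ (sym (Fin.toℕ-fromℕ< x<ℓ)) (sym (Fin.toℕ-fromℕ< y<ℓ))

Avoids132On⇒Avoids132 : ∀ {π} → Avoids132On (at π) (length π) → Avoids132 π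
Avoids132On⇒Avoids132 {π} avoids i j k i<j j<k (πᵢ<πₖ , πₖ<πⱼ) =
  avoids (suc (toℕ i)) (suc (toℕ j)) (suc (toℕ k)) (s≤s z≤n) (Fin.toℕ<n k)
    (s≤s i<j , s≤s j<k , subst₂ _<_ (lookup≡at π i) (lookup≡at π k) πᵢ<πₖ ,
                         subst₂ _<_ (lookup≡at π k) (lookup≡at π j) πₖ<πⱼ)

record Cyclic132On (f : ℕ → ℕ) (N : ℕ) : Set where
  field
    maps-into : MapsInto f N
    injective : InjectiveOn f N
    cyclic    : Cyclic f N
    avoids132 : Avoids132On f N

C132⇒Cyclic132On : ∀ {N π} → C132 N π → Cyclic132On (at π) N
C132⇒Cyclic132On {π = π} (π↭ , π-cyclic , π-avoids) = record
  { maps-into = IsPerm⇒mapsInto π↭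
  ; injective = IsPerm⇒injectiveOn π↭
  ; cyclic    = π-cyclic
  ; avoids132 = subst (Avoids132On _) (IsPerm⇒length π↭) (Avoids132⇒Avoids132On {π} π-avoids)
  }

Cyclic132On⇒C132 : ∀ {N} (π : List ℕ) → length π ≡ N → Cyclic132On (at π) N → C132 N π
Cyclic132On⇒C132 π ℓ≡N π-c132 =
  IsPerm-intro π ℓ≡N maps-into injective , cyclic ,
  Avoids132On⇒Avoids132 {π} (subst (Avoids132On _) (sym ℓ≡N) avoids132)
  where open Cyclic132On π-c132

-- The composition α ⊛ β as a map

if-yes : ∀ {P : Set} (p? : Dec P) {u v : ℕ} → P → (if does p? then u else v) ≡ u
if-yes p? p = cong (if_then _ else _) (dec-true p? p)

if-no : ∀ {P : Set} (p? : Dec P) {u v : ℕ} → ¬ P → (if does p? then u else v) ≡ v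
if-no p? ¬p = cong (if_then _ else _) (dec-false p? ¬p)

StrictlyMonotoneOn : (ℕ → Set) → (ℕ → ℕ) → Set
StrictlyMonotoneOn P f = ∀ {x y} → P x → P y → x < y → f x < f y

module _ {P : ℕ → Set} {f : ℕ → ℕ} (f-mono : StrictlyMonotoneOn P f) where

  strictMonoOn⇒reflects-< : ∀ {x y} → P x → P y → f x < f y → x < y
  strictMonoOn⇒reflects-< {x} {y} Px Py fx<fy with <-cmp x y
  ... | tri< x<y _ _ = x<y
  ... | tri≈ _ refl _ = ⊥-elim (<-irrefl refl fx<fy)
  ... | tri> _ _ y<x = ⊥-elim (<-asym fx<fy (f-mono Py Px y<x))

  strictMonoOn⇒injective : ∀ {x y} → P x → P y → f x ≡ f y → x ≡ y
  strictMonoOn⇒injective {x} {y} Px Py fx≡fy with <-cmp x y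
  ... | tri< x<y _ _ = ⊥-elim (<-irrefl fx≡fy (f-mono Px Py x<y))
  ... | tri≈ _ x≡y _ = x≡y
  ... | tri> _ _ y<x = ⊥-elim (<-irrefl (sym fx≡fy) (f-mono Py Px y<x))

Is132-reflect : ∀ {P : ℕ → Set} {h f g : ℕ → ℕ} → StrictlyMonotoneOn P h →
  ∀ {i j k I J L} → i < j → j < k → P (f i) → P (f j) → P (f k) →
  g I ≡ h (f i) → g J ≡ h (f j) → g L ≡ h (f k) → Is132 g I J L → Is132 f i j k
Is132-reflect h-mono i<j j<k Pfi Pfj Pfk gI≡ gJ≡ gL≡ (_ , _ , gI<gL , gL<gJ) =
  i<j , j<k , strictMonoOn⇒reflects-< h-mono Pfi Pfk (subst₂ _<_ gI≡ gL≡ gI<gL)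
            , strictMonoOn⇒reflects-< h-mono Pfk Pfj (subst₂ _<_ gL≡ gJ≡ gL<gJ)

-- Positions and values of α other than m
-- are moved by liftA, those of β other than n by liftB; K = m + n - 2 is the last position of the
-- β-block.
module Composition (m₁ n₁ : ℕ) where

  m n K N : ℕ
  m = suc (suc m₁)
  n = suc (suc n₁)
  K = m + n₁
  N = n₁ + 2 * m

  liftA : ℕ → ℕ
  liftA x = if does (x <? m) then x else x + n₁

  liftB : ℕ → ℕ
  liftB y = y + suc m₁

  N≡K+m : N ≡ K + m
  N≡K+m = identity m₁ n₁ where
    identity : ∀ m₁ n₁ → n₁ + 2 * suc (suc m₁) ≡ suc (suc m₁) + n₁ + suc (suc m₁)
    identity = solve-∀

  2*m≡m+m : 2 * m ≡ m + m
  2*m≡m+m = cong (m +_) (+-identityʳ m)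

  m≤2*m : m ≤ 2 * m
  m≤2*m = m≤n*m m 2

  liftA-< : ∀ {x} → x < m → liftA x ≡ x
  liftA-< {x} = if-yes (x <? m)

  liftA-≥ : ∀ {x} → m ≤ x → liftA x ≡ x + n₁
  liftA-≥ {x} m≤x = if-no (x <? m) (≤⇒≯ m≤x)

  K<liftA : ∀ {x} → m < x → K < liftA x
  K<liftA m<x rewrite liftA-≥ (<⇒≤ m<x) = +-monoˡ-< n₁ m<x

  liftA-mono : StrictlyMonotoneOn U liftA
  liftA-mono {x} {y} _ _ x<y with y <? m | x <? m
  ... | yes y<m | _ rewrite liftA-< (<-trans x<y y<m) | liftA-< y<m = x<y
  ... | no  y≮m | yes x<m rewrite liftA-< x<m | liftA-≥ (≮⇒≥ y≮m) =
    <-≤-trans x<m (≤-trans (≮⇒≥ y≮m) (m≤m+n y n₁))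
  ... | no  y≮m | no  x≮m rewrite liftA-≥ (≮⇒≥ x≮m) | liftA-≥ (≮⇒≥ y≮m) = +-monoˡ-< n₁ x<y

  m≤liftB : ∀ {y} → 1 ≤ y → m ≤ liftB y
  m≤liftB = +-monoˡ-≤ (suc m₁)

  liftB≤K : ∀ {y} → y < n → liftB y ≤ K
  liftB≤K {y} y<n = ≤-trans (+-monoˡ-≤ (suc m₁) (s≤s⁻¹ y<n))
                            (≤-reflexive (trans (+-comm (suc n₁) (suc m₁)) (+-suc (suc m₁) n₁)))

  APos BPos : ℕ → Set
  APos x = x ∈[1, 2 * m ] × x ≢ m
  BPos y = 1 ≤ y × y < n

  data Position : ℕ → Set where
    α-pos : ∀ {x} → APos x → Position (liftA x)
    β-pos : ∀ {y} → BPos y → Position (liftB y)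

  position : ∀ {p} → p ∈[1, N ] → Position p
  position {p} (1≤p , p≤N) with p <? m
  ... | yes p<m = subst Position (liftA-< p<m) (α-pos ((1≤p , ≤-trans (<⇒≤ p<m) m≤2*m) , <⇒≢ p<m))
  ... | no  p≮m with p ≤? K
  ...   | yes p≤K with d , refl ← m≤n⇒∃[o]m+o≡n (≮⇒≥ p≮m) =
    subst Position (trans (+-comm (suc d) (suc m₁)) (+-suc (suc m₁) d))
          (β-pos (s≤s z≤n , s≤s (s≤s (+-cancelˡ-≤ m d n₁ p≤K))))
  ...   | no  p≰K with d , refl ← m≤n⇒∃[o]m+o≡n (≰⇒> p≰K) =
    subst Position (trans (liftA-≥ (<⇒≤ m<x)) (identity m₁ n₁ d))
          (α-pos ((s≤s z≤n , x≤2m) , λ x≡m → <-irrefl (sym x≡m) m<x))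
    where
    open ≤-Reasoning
    identity : ∀ m₁ n₁ d → suc (suc (suc m₁) + d) + n₁ ≡ suc (suc (suc m₁) + n₁ + d)
    identity = solve-∀
    m<x : m < suc (m + d)
    m<x = s≤s (m≤m+n m d)
    d<m : d < m
    d<m = +-cancelˡ-≤ K (suc d) m (begin
      K + suc d ≡⟨ +-suc K d ⟩
      suc K + d ≤⟨ p≤N ⟩
      N         ≡⟨ N≡K+m ⟩
      K + m     ∎)
    x≤2m : suc (m + d) ≤ 2 * m
    x≤2m = begin
      suc (m + d) ≡⟨ +-suc m d ⟨
      m + suc d   ≤⟨ +-monoʳ-≤ m d<m ⟩
      m + m       ≡⟨ 2*m≡m+m ⟨
      2 * m       ∎

  liftA<liftB : ∀ {x y} → x < m → 1 ≤ y → liftA x < liftB y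
  liftA<liftB x<m 1≤y rewrite liftA-< x<m = <-≤-trans x<m (m≤liftB 1≤y)

  liftB<liftA : ∀ {x y} → m < x → y < n → liftB y < liftA x
  liftB<liftA m<x y<n = ≤-<-trans (liftB≤K y<n) (K<liftA m<x)

  ≢⇒<⊎> : ∀ {x} → x ≢ m → x < m ⊎ m < x
  ≢⇒<⊎> {x} x≢m with <-cmp x m
  ... | tri< x<m _ _ = inj₁ x<m
  ... | tri≈ _ x≡m _ = ⊥-elim (x≢m x≡m)
  ... | tri> _ _ m<x = inj₂ m<x

  liftA≢liftB : ∀ {x y} → x ≢ m → BPos y → liftA x ≢ liftB y
  liftA≢liftB x≢m (1≤y , y<n) eq with ≢⇒<⊎> x≢m
  ... | inj₁ x<m = <-irrefl eq (liftA<liftB x<m 1≤y)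
  ... | inj₂ m<x = <-irrefl (sym eq) (liftB<liftA m<x y<n)

  liftA<liftB⇒<m : ∀ {x y} → x ≢ m → y < n → liftA x < liftB y → x < m
  liftA<liftB⇒<m x≢m y<n lt with ≢⇒<⊎> x≢m
  ... | inj₁ x<m = x<m
  ... | inj₂ m<x = ⊥-elim (<-asym lt (liftB<liftA m<x y<n))

  liftB<liftA⇒m< : ∀ {x y} → x ≢ m → 1 ≤ y → liftB y < liftA x → m < x
  liftB<liftA⇒m< x≢m 1≤y lt with ≢⇒<⊎> x≢m
  ... | inj₁ x<m = ⊥-elim (<-asym lt (liftA<liftB x<m 1≤y))
  ... | inj₂ m<x = m<x

  K≤N : K ≤ N
  K≤N = subst (K ≤_) (sym N≡K+m) (m≤m+n K m)

  liftA-into : ∀ {x} → APos x → liftA x ∈[1, N ]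
  liftA-into {x} ((1≤x , x≤2m) , x≢m) with ≢⇒<⊎> x≢m
  ... | inj₁ x<m rewrite liftA-< x<m = 1≤x , ≤-trans (<⇒≤ x<m) (≤-trans (m≤m+n m n₁) K≤N)
  ... | inj₂ m<x rewrite liftA-≥ (<⇒≤ m<x) =
    ≤-trans 1≤x (m≤m+n x n₁) , subst (x + n₁ ≤_) (+-comm (2 * m) n₁) (+-monoˡ-≤ n₁ x≤2m)

  liftB-into : ∀ {y} → BPos y → liftB y ∈[1, N ]
  liftB-into (1≤y , y<n) = ≤-trans (s≤s z≤n) (m≤liftB 1≤y) , ≤-trans (liftB≤K y<n) K≤N

  module Glue (a b : ℕ → ℕ) where

    -- The paper's ᾱᵢ and β̄ᵢ, as functions of the entries αᵢ and βᵢ.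
    barα : ℕ → ℕ
    barα v = if does (v ≟ m) then liftB (b n) else liftA v

    barβ : ℕ → ℕ
    barβ w = if does (w ≟ n) then liftA (a m) else liftB w

    barα-m : barα m ≡ liftB (b n)
    barα-m = if-yes (m ≟ m) refl

    barα-≢ : ∀ {v} → v ≢ m → barα v ≡ liftA v
    barα-≢ {v} = if-no (v ≟ m)

    barβ-n : barβ n ≡ liftA (a m)
    barβ-n = if-yes (n ≟ n) refl

    barβ-≢ : ∀ {w} → w ≢ n → barβ w ≡ liftB w
    barβ-≢ {w} = if-no (w ≟ n)

    module _ (a-c132 : Cyclic132On a (2 * m)) (b-c132 : Cyclic132On b n)
             (a-upper : ∀ x → 1 ≤ x → x ≤ m → m < a x)
             (a-lower : ∀ x → m < x → x ≤ 2 * m → a x ≤ m) where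

      private
        module A = Cyclic132On a-c132
        module B = Cyclic132On b-c132

      m<am : m < a m
      m<am = a-upper m (s≤s z≤n) ≤-refl

      am≢m : a m ≢ m
      am≢m am≡m = <-irrefl (sym am≡m) m<am

      m∈ : m ∈[1, 2 * m ]
      m∈ = s≤s z≤n , m≤2*m

      n∈ : n ∈[1, n ]
      n∈ = s≤s z≤n , ≤-refl

      bn≢n : b n ≢ n
      bn≢n bn≡n = 1+n≢0 (suc-injective (InjectiveSelfMap.fixed⇒≡1 b n B.maps-into B.injective B.cyclic n n∈ bn≡n))

      bn-pos : BPos (b n)
      bn-pos = proj₁ (B.maps-into n n∈) , ≤∧≢⇒< (proj₂ (B.maps-into n n∈)) bn≢n

      barα-mono : StrictlyMonotoneOn U barα
      barα-mono {v} {w} _ _ v<w with v ≟ m | w ≟ m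
      ... | yes refl | yes refl = ⊥-elim (<-irrefl refl v<w)
      ... | yes refl | no  w≢m = subst₂ _<_ (sym barα-m) (sym (barα-≢ w≢m)) (liftB<liftA v<w (proj₂ bn-pos))
      ... | no  v≢m | yes refl = subst₂ _<_ (sym (barα-≢ v≢m)) (sym barα-m) (liftA<liftB v<w (proj₁ bn-pos))
      ... | no  v≢m | no  w≢m = subst₂ _<_ (sym (barα-≢ v≢m)) (sym (barα-≢ w≢m)) (liftA-mono _ _ v<w)

      barβ-mono : StrictlyMonotoneOn (_≤ n) barβ
      barβ-mono {v} {w} v≤n w≤n v<w with v ≟ n | w ≟ n
      ... | yes refl | _        = ⊥-elim (<⇒≱ v<w w≤n)
      ... | no  v≢n | yes refl = subst₂ _<_ (sym (barβ-≢ v≢n)) (sym barβ-n) (liftB<liftA m<am v<w)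
      ... | no  v≢n | no  w≢n = subst₂ _<_ (sym (barβ-≢ v≢n)) (sym (barβ-≢ w≢n)) (+-monoˡ-< (suc m₁) v<w)

      barα-into : ∀ {v} → v ∈[1, 2 * m ] → barα v ∈[1, N ]
      barα-into {v} v∈ with v ≟ m
      ... | yes refl = subst (_∈[1, N ]) (sym barα-m) (liftB-into bn-pos)
      ... | no  v≢m = subst (_∈[1, N ]) (sym (barα-≢ v≢m)) (liftA-into (v∈ , v≢m))

      barβ-into : ∀ {w} → w ∈[1, n ] → barβ w ∈[1, N ]
      barβ-into {w} (1≤w , w≤n) with w ≟ n
      ... | yes refl = subst (_∈[1, N ]) (sym barβ-n) (liftA-into (A.maps-into m m∈ , am≢m))
      ... | no  w≢n = subst (_∈[1, N ]) (sym (barβ-≢ w≢n)) (liftB-into (1≤w , ≤∧≢⇒< w≤n w≢n))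

      barα≡barβ : ∀ {v w} → v ∈[1, 2 * m ] → w ∈[1, n ] → barα v ≡ barβ w →
                  (v ≡ m × w ≡ b n) ⊎ (v ≡ a m × w ≡ n)
      barα≡barβ {v} {w} v∈ (1≤w , w≤n) eq with v ≟ m | w ≟ n
      ... | yes refl | yes refl = ⊥-elim (liftA≢liftB am≢m bn-pos (trans (sym barβ-n) (trans (sym eq) barα-m)))
      ... | yes refl | no  w≢n = inj₁ (refl , +-cancelʳ-≡ (suc m₁) _ _ (trans (sym (barβ-≢ w≢n)) (trans (sym eq) barα-m)))
      ... | no  v≢m | yes refl =
        inj₂ (strictMonoOn⇒injective liftA-mono _ _ (trans (sym (barα-≢ v≢m)) (trans eq barβ-n)) , refl)
      ... | no  v≢m | no  w≢n =
        ⊥-elim (liftA≢liftB v≢m (1≤w , ≤∧≢⇒< w≤n w≢n) (trans (sym (barα-≢ v≢m)) (trans eq (barβ-≢ w≢n))))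

      module _ {g : ℕ → ℕ} (g-liftA : ∀ {x} → APos x → g (liftA x) ≡ barα (a x))
                           (g-liftB : ∀ {y} → BPos y → g (liftB y) ≡ barβ (b y)) where

        BPos⇒∈ : ∀ {y} → BPos y → y ∈[1, n ]
        BPos⇒∈ (1≤y , y<n) = 1≤y , <⇒≤ y<n

        into-≤n : ∀ {y} → BPos y → b y ≤ n
        into-≤n y-pos = proj₂ (B.maps-into _ (BPos⇒∈ y-pos))

        g-into : MapsInto g N
        g-into p p∈ with position p∈
        ... | α-pos x-pos = subst (_∈[1, N ]) (sym (g-liftA x-pos)) (barα-into (A.maps-into _ (proj₁ x-pos)))
        ... | β-pos y-pos = subst (_∈[1, N ]) (sym (g-liftB y-pos)) (barβ-into (B.maps-into _ (BPos⇒∈ y-pos)))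

        g-liftA≢g-liftB : ∀ {x y} → APos x → BPos y → g (liftA x) ≢ g (liftB y)
        g-liftA≢g-liftB {x} {y} x-pos@(x∈ , x≢m) y-pos@(_ , y<n) eq
          with barα≡barβ (A.maps-into x x∈) (B.maps-into y (BPos⇒∈ y-pos))
                         (trans (sym (g-liftA x-pos)) (trans eq (g-liftB y-pos)))
        ... | inj₁ (_ , by≡bn) = <-irrefl (B.injective y n (BPos⇒∈ y-pos) n∈ by≡bn) y<n
        ... | inj₂ (ax≡am , _) = x≢m (A.injective x m x∈ m∈ ax≡am)

        g-injective : InjectiveOn g N
        g-injective p q p∈ q∈ eq with position p∈ | position q∈
        ... | α-pos x-pos | α-pos x′-pos = cong liftA (A.injective _ _ (proj₁ x-pos) (proj₁ x′-pos)
          (strictMonoOn⇒injective barα-mono _ _ (trans (sym (g-liftA x-pos)) (trans eq (g-liftA x′-pos)))))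
        ... | α-pos x-pos | β-pos y-pos = ⊥-elim (g-liftA≢g-liftB x-pos y-pos eq)
        ... | β-pos y-pos | α-pos x-pos = ⊥-elim (g-liftA≢g-liftB x-pos y-pos (sym eq))
        ... | β-pos y-pos | β-pos y′-pos = cong liftB (B.injective _ _ (BPos⇒∈ y-pos) (BPos⇒∈ y′-pos)
          (strictMonoOn⇒injective barβ-mono (into-≤n y-pos) (into-≤n y′-pos)
            (trans (sym (g-liftB y-pos)) (trans eq (g-liftB y′-pos)))))

        left-high : ∀ {x} → APos x → x < m → K < g (liftA x)
        left-high x-pos@((1≤x , _) , _) x<m = subst (K <_) (sym (trans (g-liftA x-pos) (barα-≢ ax≢m))) (K<liftA m<ax)
          where
          m<ax = a-upper _ 1≤x (<⇒≤ x<m)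
          ax≢m = λ ax≡m → <-irrefl (sym ax≡m) m<ax

        right-low : ∀ {x} → APos x → m < x → g (liftA x) ≤ K
        right-low {x} x-pos@((_ , x≤2m) , _) m<x with a x ≟ m
        ... | yes ax≡m rewrite g-liftA x-pos | ax≡m | barα-m = liftB≤K (proj₂ bn-pos)
        ... | no  ax≢m rewrite g-liftA x-pos | barα-≢ ax≢m | liftA-< (≤∧≢⇒< (a-lower x m<x x≤2m) ax≢m) =
          ≤-trans (a-lower x m<x x≤2m) (m≤m+n m n₁)

        right-m : ∀ {x} → APos x → m < x → m ≤ g (liftA x) → a x ≡ m
        right-m {x} x-pos@((_ , x≤2m) , _) m<x m≤gx with a x ≟ m
        ... | yes ax≡m = ax≡m
        ... | no  ax≢m rewrite g-liftA x-pos | barα-≢ ax≢m | liftA-< (≤∧≢⇒< (a-lower x m<x x≤2m) ax≢m) =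
          ⊥-elim (<⇒≱ (≤∧≢⇒< (a-lower x m<x x≤2m) ax≢m) m≤gx)

        middle-≥m : ∀ {y} → BPos y → m ≤ g (liftB y)
        middle-≥m {y} y-pos with b y ≟ n
        ... | yes by≡n rewrite g-liftB y-pos | by≡n | barβ-n = ≤-trans (m≤m+n m n₁) (<⇒≤ (K<liftA m<am))
        ... | no  by≢n rewrite g-liftB y-pos | barβ-≢ by≢n = m≤liftB (proj₁ (B.maps-into _ (BPos⇒∈ y-pos)))

        middle-high : ∀ {y} → BPos y → K < g (liftB y) → b y ≡ n
        middle-high {y} y-pos K<gy with b y ≟ n
        ... | yes by≡n = by≡n
        ... | no  by≢n rewrite g-liftB y-pos | barβ-≢ by≢n =
          ⊥-elim (<⇒≱ K<gy (liftB≤K (≤∧≢⇒< (proj₂ (B.maps-into _ (BPos⇒∈ y-pos))) by≢n)))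

        g-liftA-m : ∀ {x} → APos x → a x ≡ m → g (liftA x) ≡ barβ (b n)
        g-liftA-m x-pos ax≡m = trans (g-liftA x-pos) (trans (cong barα ax≡m) (trans barα-m (sym (barβ-≢ bn≢n))))

        g-liftB-n : ∀ {y} → BPos y → b y ≡ n → g (liftB y) ≡ barα (a m)
        g-liftB-n y-pos by≡n = trans (g-liftB y-pos) (trans (cong barβ by≡n) (trans barβ-n (sym (barα-≢ am≢m))))

        liftA-reflects-< : ∀ {x x′} → liftA x < liftA x′ → x < x′
        liftA-reflects-< = strictMonoOn⇒reflects-< liftA-mono _ _

        liftB-reflects-< : ∀ {y y′} → liftB y < liftB y′ → y < y′
        liftB-reflects-< = +-cancelʳ-< (suc m₁) _ _

        no-132-α : ∀ {x j k} → APos x → Position j → Position k → ¬ Is132 g (liftA x) j k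
        no-132-α xi (α-pos xj) (α-pos xk) pat@(i<j , j<k , _) =
          A.avoids132 _ _ _ (proj₁ (proj₁ xi)) (proj₂ (proj₁ xk))
            (Is132-reflect {f = a} {g} barα-mono (liftA-reflects-< i<j) (liftA-reflects-< j<k) _ _ _
                           (g-liftA xi) (g-liftA xj) (g-liftA xk) pat)
        no-132-α xi (α-pos xj) (β-pos yk) pat@(i<j , j<k , gi<gk , _) =
          A.avoids132 _ _ m (proj₁ (proj₁ xi)) m≤2*m
            (Is132-reflect {f = a} {g} barα-mono xi<xj xj<m _ _ _ (g-liftA xi) (g-liftA xj) (g-liftB-n yk byk≡n) pat)
          where
          xi<xj = liftA-reflects-< i<j
          xj<m  = liftA<liftB⇒<m (proj₂ xj) (proj₂ yk) j<k
          byk≡n = middle-high yk (<-trans (left-high xi (<-trans xi<xj xj<m)) gi<gk)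
        no-132-α xi (β-pos yj) (α-pos xk) (i<j , j<k , gi<gk , _) =
          <-asym gi<gk (≤-<-trans (right-low xk (liftB<liftA⇒m< (proj₂ xk) (proj₁ yj) j<k))
                                  (left-high xi (liftA<liftB⇒<m (proj₂ xi) (proj₂ yj) i<j)))
        no-132-α xi (β-pos yj) (β-pos yk) (i<j , j<k , gi<gk , gk<gj) =
          <⇒≱ (strictMonoOn⇒reflects-< barβ-mono (into-≤n yk) (into-≤n yj)
                 (subst₂ _<_ (g-liftB yk) (g-liftB yj) gk<gj))
              (subst (b _ ≤_) (sym byk≡n) (into-≤n yj))
          where byk≡n = middle-high yk (<-trans (left-high xi (liftA<liftB⇒<m (proj₂ xi) (proj₂ yj) i<j)) gi<gk)

        no-132-β : ∀ {y j k} → BPos y → Position j → Position k → ¬ Is132 g (liftB y) j k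
        no-132-β yi (α-pos xj) (α-pos xk) (i<j , j<k , gi<gk , gk<gj) =
          <⇒≱ (strictMonoOn⇒reflects-< barα-mono _ _ (subst₂ _<_ (g-liftA xk) (g-liftA xj) gk<gj))
              (subst (a _ ≤_) (sym axk≡m) (a-lower _ m<xj (proj₂ (proj₁ xj))))
          where
          m<xj  = liftB<liftA⇒m< (proj₂ xj) (proj₁ yi) i<j
          axk≡m = right-m xk (<-trans m<xj (liftA-reflects-< j<k)) (<⇒≤ (≤-<-trans (middle-≥m yi) gi<gk))
        no-132-β yi (α-pos xj) (β-pos yk) (i<j , j<k , _) =
          <-asym (liftB<liftA⇒m< (proj₂ xj) (proj₁ yi) i<j) (liftA<liftB⇒<m (proj₂ xj) (proj₂ yk) j<k)
        no-132-β yi (β-pos yj) (α-pos xk) pat@(i<j , j<k , gi<gk , _) =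
          B.avoids132 _ _ n (proj₁ yi) ≤-refl
            (Is132-reflect {f = b} {g} barβ-mono (liftB-reflects-< i<j) (proj₂ yj)
                           (into-≤n yi) (into-≤n yj) (proj₂ (B.maps-into n n∈))
                           (g-liftB yi) (g-liftB yj) (g-liftA-m xk axk≡m) pat)
          where
          m<xk  = liftB<liftA⇒m< (proj₂ xk) (proj₁ yj) j<k
          axk≡m = right-m xk m<xk (<⇒≤ (≤-<-trans (middle-≥m yi) gi<gk))
        no-132-β yi (β-pos yj) (β-pos yk) pat@(i<j , j<k , _) =
          B.avoids132 _ _ _ (proj₁ yi) (<⇒≤ (proj₂ yk))
            (Is132-reflect {f = b} {g} barβ-mono (liftB-reflects-< i<j) (liftB-reflects-< j<k)
                           (into-≤n yi) (into-≤n yj) (into-≤n yk)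
                           (g-liftB yi) (g-liftB yj) (g-liftB yk) pat)

        no-132 : ∀ {i j k} → Position i → Position j → Position k → ¬ Is132 g i j k
        no-132 (α-pos xi) = no-132-α xi
        no-132 (β-pos yi) = no-132-β yi

        g-avoids132 : Avoids132On g N
        g-avoids132 i j k 1≤i k≤N pat@(i<j , j<k , _) =
          no-132 (position (1≤i , ≤-trans (<⇒≤ (<-trans i<j j<k)) k≤N))
                 (position (≤-trans 1≤i (<⇒≤ i<j) , ≤-trans (<⇒≤ j<k) k≤N))
                 (position (≤-trans 1≤i (<⇒≤ (<-trans i<j j<k)) , k≤N)) pat

        private
          module SpliceA = Splice a g liftA (2 * m) m (liftB (b n)) A.maps-into am≢m
            (λ x x∈ x≢m ax≢m → trans (g-liftA (x∈ , x≢m)) (barα-≢ ax≢m))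
            (λ x x∈ x≢m ax≡m → trans (g-liftA (x∈ , x≢m)) (trans (cong barα ax≡m) barα-m))
          module SpliceB = Splice b g liftB n n (liftA (a m)) B.maps-into bn≢n
            (λ y (1≤y , y≤n) y≢n by≢n → trans (g-liftB (1≤y , ≤∧≢⇒< y≤n y≢n)) (barβ-≢ by≢n))
            (λ y (1≤y , y≤n) y≢n by≡n → trans (g-liftB (1≤y , ≤∧≢⇒< y≤n y≢n)) (trans (cong barβ by≡n) barβ-n))
          module OrbitA = InjectiveSelfMap a (2 * m) A.maps-into A.injective
          module OrbitB = InjectiveSelfMap b n B.maps-into B.injective

        A→B : Reaches g (liftA (a m)) (liftB (b n))
        A→B = SpliceA.reaches-exit (A.maps-into m m∈) am≢m (OrbitA.connected A.cyclic (a m) m (A.maps-into m m∈) m∈)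

        B→A : Reaches g (liftB (b n)) (liftA (a m))
        B→A = SpliceB.reaches-exit (B.maps-into n n∈) bn≢n (OrbitB.connected B.cyclic (b n) n (B.maps-into n n∈) n∈)

        1∈ : 1 ∈[1, 2 * m ]
        1∈ = ≤-refl , ≤-trans (s≤s z≤n) m≤2*m

        bn∈ : b n ∈[1, n ]
        bn∈ = BPos⇒∈ bn-pos

        from-liftA1 : ∀ {p} → Reaches g (liftA 1) p → Reaches g 1 p
        from-liftA1 {p} = subst (λ q → Reaches g q p) (liftA-< (s≤s (s≤s z≤n)))

        g-cyclic : Cyclic g N
        g-cyclic j 1≤j j≤N with position (1≤j , j≤N)
        ... | α-pos {x} ((1≤x , x≤2m) , x≢m) =
          from-liftA1 (SpliceA.reaches B→A 1∈ (λ ()) x≢m (A.cyclic x 1≤x x≤2m))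
        ... | β-pos y-pos@(_ , y<n) =
          reaches-trans (from-liftA1 (SpliceA.reaches-exit 1∈ (λ ()) (A.cyclic m (s≤s z≤n) m≤2*m)))
                        (SpliceB.reaches A→B bn∈ bn≢n (<⇒≢ y<n) (OrbitB.connected B.cyclic (b n) _ bn∈ (BPos⇒∈ y-pos)))

        composition-cyclic132 : Cyclic132On g N
        composition-cyclic132 = record
          { maps-into = g-into ; injective = g-injective ; cyclic = g-cyclic ; avoids132 = g-avoids132 }

-- The one-line word α ⊛ β

module _ {m} {π : List ℕ} (π↭ : IsPerm (2 * m) π) (front : take m π ↭ range m m) where

  private
    m≤ℓ : m ≤ length π
    m≤ℓ = subst (m ≤_) (sym (IsPerm⇒length π↭)) (m≤n*m m 2)

    at-front : ∀ i → i < m → at π (suc i) ∈ range m m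
    at-front i i<m = ∈-resp-↭ front (subst (_∈ take m π) (at-take m π i i<m)
      (at-∈ (take m π) i (subst (i <_) (sym (length-take-≤ m π m≤ℓ)) i<m)))

  front-above : ∀ x → 1 ≤ x → x ≤ m → m < at π x
  front-above (suc i) _ i<m = proj₁ (∈-range⁻ (at-front i i<m))

  back-below : ∀ x → m < x → x ≤ 2 * m → at π x ≤ m
  back-below x m<x x≤2m with at π x ≤? m
  ... | yes πx≤m = πx≤m
  ... | no  πx≰m = ⊥-elim (<⇒≱ m<x (in-front (∈-range⁺ (≰⇒> πx≰m) πx≤2m)))
    where
    x∈ : x ∈[1, 2 * m ]
    x∈ = ≤-trans (s≤s z≤n) m<x , x≤2m
    πx≤2m : at π x ≤ m + m
    πx≤2m = subst (at π x ≤_) (cong (m +_) (+-identityʳ m)) (proj₂ (IsPerm⇒mapsInto π↭ x x∈))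
    in-front : at π x ∈ range m m → x ≤ m
    in-front πx∈ with i , i<ℓ , eq ← ∈⇒at (∈-resp-↭ (↭-sym front) πx∈) =
      x≤m (subst (_ <_) (length-take-≤ m π m≤ℓ) i<ℓ)
      where
      x≤m : i < m → x ≤ m
      x≤m i<m = subst (_≤ m) (sym (IsPerm⇒injectiveOn π↭ x (suc i) x∈ (s≤s z≤n , ≤-trans i<m (m≤n*m m 2))
                                                      (trans (sym eq) (at-take m π i i<m)))) i<m

at-map-take : ∀ (f : ℕ → ℕ) k (xs : List ℕ) i → i < k → k ≤ length xs →
  at (map f (take k xs)) (suc i) ≡ f (at xs (suc i))
at-map-take f k xs i i<k k≤ℓ =
  trans (at-map f (take k xs) i (subst (i <_) (sym (length-take-≤ k xs k≤ℓ)) i<k)) (cong f (at-take k xs i i<k))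

at-map-drop : ∀ (f : ℕ → ℕ) k (xs : List ℕ) i → i + k < length xs →
  at (map f (drop k xs)) (suc i) ≡ f (at xs (suc (k + i)))
at-map-drop f k xs i i+k<ℓ =
  trans (at-map f (drop k xs) i (subst (i <_) (sym (length-drop k xs)) (m+n≤o⇒m≤o∸n (suc i) i+k<ℓ)))
        (cong f (at-drop k xs i))

module OneLine (m₁ n₁ : ℕ) (α β : List ℕ)
               (ℓα : length α ≡ 2 * suc (suc m₁)) (ℓβ : length β ≡ suc (suc n₁)) where

  open Composition m₁ n₁

  left-entry middle-entry right-entry : ℕ → ℕ
  left-entry v   = v + n ∸ 2
  middle-entry w = if w ≡ᵇ n then at α m + n ∸ 2 else w + m ∸ 1
  right-entry v  = if v ≡ᵇ m then at β n + m ∸ 1 else v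

  left middle right : List ℕ
  left   = map left-entry (take (suc m₁) α)
  middle = map middle-entry (take (suc n₁) β)
  right  = map right-entry (drop m α)

  γ : List ℕ
  γ = circledast m n α β

  1+m₁≤ℓα : suc m₁ ≤ length α
  1+m₁≤ℓα = subst (suc m₁ ≤_) (sym ℓα) (≤-trans (n≤1+n _) m≤2*m)

  1+n₁≤ℓβ : suc n₁ ≤ length β
  1+n₁≤ℓβ = subst (suc n₁ ≤_) (sym ℓβ) (n≤1+n _)

  ℓ-left : length left ≡ suc m₁
  ℓ-left = trans (length-map left-entry (take (suc m₁) α)) (length-take-≤ (suc m₁) α 1+m₁≤ℓα)

  ℓ-middle : length middle ≡ suc n₁
  ℓ-middle = trans (length-map middle-entry (take (suc n₁) β)) (length-take-≤ (suc n₁) β 1+n₁≤ℓβ)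

  ℓ-right : length right ≡ m
  ℓ-right = trans (length-map right-entry (drop m α))
                  (trans (length-drop m α) (trans (cong (_∸ m) (trans ℓα 2*m≡m+m)) (m+n∸n≡m m m)))

  length-γ : length γ ≡ N
  length-γ = begin
    length (left ++ middle ++ right)             ≡⟨ length-++ left ⟩
    length left + length (middle ++ right)       ≡⟨ cong (length left +_) (length-++ middle) ⟩
    length left + (length middle + length right) ≡⟨ cong₂ _+_ ℓ-left (cong₂ _+_ ℓ-middle ℓ-right) ⟩
    suc m₁ + (suc n₁ + m)                        ≡⟨ identity m₁ n₁ ⟩
    N                                            ∎
    where
    open ≡-Reasoning
    identity : ∀ m₁ n₁ → suc m₁ + (suc n₁ + suc (suc m₁)) ≡ n₁ + 2 * suc (suc m₁)
    identity = solve-∀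

  at-left : ∀ i → i < suc m₁ → at γ (suc i) ≡ left-entry (at α (suc i))
  at-left i i<1+m₁ = trans (at-++ˡ left (middle ++ right) i (subst (i <_) (sym ℓ-left) i<1+m₁))
                           (at-map-take left-entry (suc m₁) α i i<1+m₁ 1+m₁≤ℓα)

  at-middle : ∀ j → j < suc n₁ → at γ (suc (suc m₁ + j)) ≡ middle-entry (at β (suc j))
  at-middle j j<1+n₁ = begin
    at γ (suc (suc m₁ + j))                   ≡⟨ cong (λ l → at γ (suc (l + j))) ℓ-left ⟨
    at γ (suc (length left + j))              ≡⟨ at-++ʳ left (middle ++ right) j ⟩
    at (middle ++ right) (suc j)              ≡⟨ at-++ˡ middle right j (subst (j <_) (sym ℓ-middle) j<1+n₁) ⟩
    at middle (suc j)                         ≡⟨ at-map-take middle-entry (suc n₁) β j j<1+n₁ 1+n₁≤ℓβ ⟩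
    middle-entry (at β (suc j))               ∎
    where open ≡-Reasoning

  at-right : ∀ j → j < m → at γ (suc (suc m₁ + (suc n₁ + j))) ≡ right-entry (at α (suc (m + j)))
  at-right j j<m = begin
    at γ (suc (suc m₁ + (suc n₁ + j)))        ≡⟨ cong (λ l → at γ (suc (l + (suc n₁ + j)))) ℓ-left ⟨
    at γ (suc (length left + (suc n₁ + j)))   ≡⟨ at-++ʳ left (middle ++ right) (suc n₁ + j) ⟩
    at (middle ++ right) (suc (suc n₁ + j))   ≡⟨ cong (λ l → at (middle ++ right) (suc (l + j))) ℓ-middle ⟨
    at (middle ++ right) (suc (length middle + j)) ≡⟨ at-++ʳ middle right j ⟩
    at right (suc j)                          ≡⟨ at-map-drop right-entry m α j j+m<ℓα ⟩
    right-entry (at α (suc (m + j)))          ∎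
    where
    open ≡-Reasoning
    j+m<ℓα : j + m < length α
    j+m<ℓα = subst (j + m <_) (sym (trans ℓα 2*m≡m+m)) (+-monoˡ-< m j<m)

  open Glue (at α) (at β)

  module _ (a-upper : ∀ x → 1 ≤ x → x ≤ m → m < at α x)
           (a-lower : ∀ x → m < x → x ≤ 2 * m → at α x ≤ m) where

    left-entry≡barα : ∀ {v} → m < v → left-entry v ≡ barα v
    left-entry≡barα {v} m<v = begin
      v + n ∸ 2   ≡⟨ +-∸-assoc v (s≤s (s≤s z≤n)) ⟩
      v + n₁      ≡⟨ liftA-≥ (<⇒≤ m<v) ⟨
      liftA v     ≡⟨ barα-≢ (λ v≡m → <-irrefl (sym v≡m) m<v) ⟨
      barα v      ∎
      where open ≡-Reasoning

    middle-entry≡barβ : ∀ w → middle-entry w ≡ barβ w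
    middle-entry≡barβ w with w ≟ n
    ... | yes refl = begin
      middle-entry n       ≡⟨ if-yes (n ≟ n) refl ⟩
      left-entry (at α m)  ≡⟨ left-entry≡barα (a-upper m (s≤s z≤n) ≤-refl) ⟩
      barα (at α m)        ≡⟨ barα-≢ (λ αm≡m → <-irrefl (sym αm≡m) (a-upper m (s≤s z≤n) ≤-refl)) ⟩
      liftA (at α m)       ≡⟨ barβ-n ⟨
      barβ n               ∎
      where open ≡-Reasoning
    ... | no  w≢n = trans (if-no (w ≟ n) w≢n) (trans (+-∸-assoc w (s≤s z≤n)) (sym (barβ-≢ w≢n)))

    right-entry≡barα : ∀ {v} → v ≤ m → right-entry v ≡ barα v
    right-entry≡barα {v} v≤m with v ≟ m
    ... | yes refl = trans (if-yes (m ≟ m) refl) (trans (+-∸-assoc (at β n) (s≤s z≤n)) (sym barα-m))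
    ... | no  v≢m = trans (if-no (v ≟ m) v≢m) (sym (trans (barα-≢ v≢m) (liftA-< (≤∧≢⇒< v≤m v≢m))))

    γ-liftA : ∀ {x} → APos x → at γ (liftA x) ≡ barα (at α x)
    γ-liftA {x} ((1≤x , x≤2m) , x≢m) with ≢⇒<⊎> x≢m
    γ-liftA {suc i} ((1≤x , _) , _) | inj₁ x<m = begin
      at γ (liftA (suc i))        ≡⟨ cong (at γ) (liftA-< x<m) ⟩
      at γ (suc i)                ≡⟨ at-left i (s≤s⁻¹ x<m) ⟩
      left-entry (at α (suc i))   ≡⟨ left-entry≡barα (a-upper (suc i) 1≤x (<⇒≤ x<m)) ⟩
      barα (at α (suc i))         ∎
      where open ≡-Reasoning
    γ-liftA {x} ((_ , x≤2m) , _) | inj₂ m<x with j , refl ← m≤n⇒∃[o]m+o≡n m<x = γ-liftA-right j x≤2m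
      where
      γ-liftA-right : ∀ j → suc (m + j) ≤ 2 * m → at γ (liftA (suc (m + j))) ≡ barα (at α (suc (m + j)))
      γ-liftA-right j x≤2m = begin
        at γ (liftA (suc (m + j)))                ≡⟨ cong (at γ) (trans (liftA-≥ (<⇒≤ m<1+m+j)) (identity m₁ n₁ j)) ⟩
        at γ (suc (suc m₁ + (suc n₁ + j)))        ≡⟨ at-right j j<m ⟩
        right-entry (at α (suc (m + j)))          ≡⟨ right-entry≡barα (a-lower _ m<1+m+j x≤2m) ⟩
        barα (at α (suc (m + j)))                 ∎
        where
        open ≡-Reasoning
        identity : ∀ m₁ n₁ j → suc (suc (suc m₁) + j) + n₁ ≡ suc (suc m₁ + (suc n₁ + j))
        identity = solve-∀
        m<1+m+j : m < suc (m + j)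
        m<1+m+j = s≤s (m≤m+n m j)
        j<m : j < m
        j<m = +-cancelˡ-< m j m (subst (suc (m + j) ≤_) 2*m≡m+m x≤2m)

    γ-liftB : ∀ {y} → BPos y → at γ (liftB y) ≡ barβ (at β y)
    γ-liftB {suc j} (_ , y<n) = begin
      at γ (suc j + suc m₁)        ≡⟨ cong (λ p → at γ (suc p)) (+-comm j (suc m₁)) ⟩
      at γ (suc (suc m₁ + j))      ≡⟨ at-middle j (s≤s⁻¹ y<n) ⟩
      middle-entry (at β (suc j))  ≡⟨ middle-entry≡barβ (at β (suc j)) ⟩
      barβ (at β (suc j))          ∎
      where open ≡-Reasoning

lemma6p3 : (m n : ℕ) → 2 ≤ m → 2 ≤ n →
    (α β : List ℕ) →
    C132 (2 * m) α → take m α ↭ range m m → C132 n β →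
    C132 (n + 2 * m ∸ 2) (circledast m n α β)
lemma6p3 0                _                ()       _        _ _ _ _ _
lemma6p3 1                _                (s≤s ()) _        _ _ _ _ _
lemma6p3 (suc (suc _))    0                _        ()       _ _ _ _ _
lemma6p3 (suc (suc _))    1                _        (s≤s ()) _ _ _ _ _
lemma6p3 (suc (suc m₁))   (suc (suc n₁))   _        _        α β α-c132@(α↭ , _) front β-c132@(β↭ , _) =
  Cyclic132On⇒C132 γ length-γ
    (composition-cyclic132 (C132⇒Cyclic132On α-c132) (C132⇒Cyclic132On β-c132) α-upper α-lower
                           (γ-liftA α-upper α-lower) (γ-liftB α-upper α-lower))
  where
  open Composition m₁ n₁
  open Glue (at α) (at β)
  open OneLine m₁ n₁ α β (IsPerm⇒length α↭) (IsPerm⇒length β↭)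
  α-upper : ∀ x → 1 ≤ x → x ≤ m → m < at α x
  α-upper = front-above α↭ front
  α-lower : ∀ x → m < x → x ≤ 2 * m → at α x ≤ m
  α-lower = back-below α↭ front
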